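{- Let $k\ge1$ be an integer. For every finite simple graph $G$ of order $n$ with maximum degree $\Delta$, $d_R^k(G)\le \max\{\Delta,k-1\}+k$.
   Context: Let $k\ge1$ be an integer. A Roman $k$-dominating function (RkDF) on a graph $G$ is a map $f:V(G)\to\{0,1,2\}$ such that every vertex $v$ with $f(v)=0$ has at least $k$ neighbors $u$ with $f(u)=2$. A set $\{f_1,\ldots,f_d\}$ of pairwise distinct RkDFs on $G$ with $\sum_{i=1}^d f_i(v)\le 2k$ for every $v\in V(G)$ is a Roman $(k,k)$-dominating family on $G$; the maximum number of functions in such a family is the Roman $(k,k)$-domatic number $d_R^k(G)$. -}

module Defs where

open import Data.Nat using (ℕ; zero; suc; _+_; _*_; _≤_; _⊔_)
open import Data.Bool using (Bool; true; false; _∧_; if_then_else_)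
open import Data.Fin using (Fin; zero; suc; toℕ)
open import Relation.Binary.PropositionalEquality using (_≡_; _≢_)
open import Relation.Nullary using (¬_)

record Graph (n : ℕ) : Set where
  field
    Adj    : Fin n → Fin n → Bool
    sym    : ∀ u v → Adj u v ≡ Adj v u
    irrefl : ∀ v → Adj v v ≡ false
open Graph public

count : ∀ {n} → (Fin n → Bool) → ℕ
count {zero}  p = 0
count {suc n} p = (if p zero then 1 else 0) + count (λ i → p (suc i))

sumFin : ∀ {d} → (Fin d → ℕ) → ℕ
sumFin {zero}  g = 0
sumFin {suc d} g = g zero + sumFin (λ i → g (suc i))

maxFin : ∀ {n} → (Fin n → ℕ) → ℕ
maxFin {zero}  g = 0
maxFin {suc n} g = g zero ⊔ maxFin (λ i → g (suc i))

degree : ∀ {n} → Graph n → Fin n → ℕ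
degree G v = count (Adj G v)

maxDegree : ∀ {n} → Graph n → ℕ
maxDegree G = maxFin (degree G)

-- Roman functions f : V → {0,1,2}, values encoded as Fin 3
isTwo : Fin 3 → Bool
isTwo (suc (suc zero)) = true
isTwo _                = false

IsRkDF : ∀ {n} → ℕ → Graph n → (Fin n → Fin 3) → Set
IsRkDF k G f = ∀ v → f v ≡ zero → k ≤ count (λ u → Adj G v u ∧ isTwo (f u))

record IsRkkFamily {n d : ℕ} (k : ℕ) (G : Graph n) (fam : Fin d → Fin n → Fin 3) : Set where
  field
    each     : ∀ i → IsRkDF k G (fam i)
    distinct : ∀ i j → i ≢ j → ¬ (∀ v → fam i v ≡ fam j v)
    bounded  : ∀ v → sumFin (λ i → toℕ (fam i v)) ≤ 2 * k

module Submission where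

-- For a vertex u let z(u), o(u), t(u) be the numbers of functions of the family
-- taking the value 0, 1, 2 at u, so that d = z(u) + o(u) + t(u), and the weight
-- bound Σᵢ fᵢ(u) ≤ 2k reads o(u) + 2 t(u) ≤ 2k.
--
-- * If k ≤ Δ we double count: every 0 of some fᵢ at v is seen by k neighbours
--   carrying a 2 of fᵢ, and a 2 at u is seen by at most Δ vertices, hence
--   k Σᵥ z(v) ≤ Δ Σᵤ t(u).  Together with the elementary per-vertex inequality
--   Δ t + k (o + t) ≤ k (Δ + k) this gives n k d ≤ n k (Δ + k), i.e. d ≤ Δ + k.
-- * If Δ < k no function can take the value 0 (a vertex has fewer than k
--   neighbours).  If d ≥ 2k, the d positive values Σᵢ fᵢ(u) ≤ 2k ≤ d are then
--   all equal to 1, so all members of the family coincide — impossible since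
--   they are pairwise distinct and d ≥ 2.  Hence d ≤ 2k − 1.

open import Defs hiding (sym)
open import Data.Nat using (ℕ; _+_; _∸_; _≤_; _⊔_)
open import Data.Fin using (Fin)
open import Data.Nat using (zero; suc; _*_; _<_; _<?_; z≤n; s≤s; NonZero; >-nonZero)
open import Data.Nat.Properties
open import Data.Nat.Tactic.RingSolver using (solve-∀)
open import Data.Fin using (zero; suc; toℕ)
open import Data.Fin.Properties using (toℕ-injective)
open import Data.Bool using (Bool; true; false; _∧_)
open import Data.Product using (_,_)
open import Data.Empty using (⊥-elim)
open import Relation.Nullary using (¬_; yes; no)
open import Relation.Binary.PropositionalEquality
open import Algebra.Properties.Semiring.Sum +-*-semiring
  using (sum; sum-syntax; sum-cong-≗; ∑-distrib-+; ∑-comm; *-distribˡ-sum; *-distribʳ-sum)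

sumFin≡sum : ∀ {n} (g : Fin n → ℕ) → sumFin g ≡ sum g
sumFin≡sum {zero}  g = refl
sumFin≡sum {suc n} g = cong (g zero +_) (sumFin≡sum (λ i → g (suc i)))

sum-mono : ∀ {n} {f g : Fin n → ℕ} → (∀ i → f i ≤ g i) → sum f ≤ sum g
sum-mono {zero}  f≤g = z≤n
sum-mono {suc n} f≤g = +-mono-≤ (f≤g zero) (sum-mono (λ i → f≤g (suc i)))

sum-const : ∀ n c → ∑[ i < n ] c ≡ n * c
sum-const zero    c = refl
sum-const (suc n) c = cong (c +_) (sum-const n c)

sum-positive : ∀ {d} (g : Fin d → ℕ) → (∀ i → 1 ≤ g i) → d ≤ sum g
sum-positive {d} g pos =
  ≤-trans (≤-reflexive (sym (trans (sum-const d 1) (*-identityʳ d)))) (sum-mono pos)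

sum-tight : ∀ {d} (g : Fin d → ℕ) → (∀ i → 1 ≤ g i) → sum g ≤ d → ∀ i → g i ≡ 1
sum-tight {suc d} g pos sum≤ zero = ≤-antisym head≤1 (pos zero)
  where
  head≤1 : g zero ≤ 1
  head≤1 = +-cancelʳ-≤ d (g zero) 1
             (≤-trans (+-monoʳ-≤ (g zero) (sum-positive (λ j → g (suc j)) (λ j → pos (suc j)))) sum≤)
sum-tight {suc d} g pos sum≤ (suc j) =
  sum-tight (λ i → g (suc i)) (λ i → pos (suc i))
            (+-cancelˡ-≤ 1 _ _ (≤-trans (+-monoˡ-≤ _ (pos zero)) sum≤)) j

ind : Bool → ℕ
ind true  = 1
ind false = 0

ind-∧ : ∀ a b → ind (a ∧ b) ≡ ind a * ind b
ind-∧ true  b = sym (+-identityʳ (ind b))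
ind-∧ false b = refl

ind-∧-≤ : ∀ a b → ind (a ∧ b) ≤ ind a
ind-∧-≤ true  true  = ≤-refl
ind-∧-≤ true  false = z≤n
ind-∧-≤ false b     = z≤n

count≡sum : ∀ {n} (p : Fin n → Bool) → count p ≡ ∑[ i < n ] ind (p i)
count≡sum {zero}  p = refl
count≡sum {suc n} p with p zero
... | true  = cong suc (count≡sum (λ i → p (suc i)))
... | false = count≡sum (λ i → p (suc i))

count-∧ : ∀ {n} (p q : Fin n → Bool) → count (λ i → p i ∧ q i) ≡ ∑[ i < n ] (ind (p i) * ind (q i))
count-∧ p q = trans (count≡sum (λ i → p i ∧ q i)) (sum-cong-≗ (λ i → ind-∧ (p i) (q i)))

count-∧-≤ : ∀ {n} (p q : Fin n → Bool) → count (λ i → p i ∧ q i) ≤ count p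
count-∧-≤ p q = subst₂ _≤_ (sym (count≡sum (λ i → p i ∧ q i))) (sym (count≡sum p))
                        (sum-mono (λ i → ind-∧-≤ (p i) (q i)))

≤maxFin : ∀ {n} (g : Fin n → ℕ) i → g i ≤ maxFin g
≤maxFin g zero    = m≤m⊔n _ _
≤maxFin g (suc i) = ≤-trans (≤maxFin (λ j → g (suc j)) i) (m≤n⊔m _ _)

-- A graph of positive maximum degree has a vertex; needed to cancel the order n.
nonEmpty : ∀ {n} (G : Graph n) → 1 ≤ maxDegree G → NonZero n
nonEmpty {suc n} G _ = _

isZero isOne : Fin 3 → Bool
isZero zero = true
isZero _    = false
isOne (suc zero) = true
isOne _          = false

value-partition : ∀ x → ind (isZero x) + ind (isOne x) + ind (isTwo x) ≡ 1
value-partition zero             = refl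
value-partition (suc zero)       = refl
value-partition (suc (suc zero)) = refl

value-weight : ∀ x → toℕ x ≡ ind (isOne x) + 2 * ind (isTwo x)
value-weight zero             = refl
value-weight (suc zero)       = refl
value-weight (suc (suc zero)) = refl

-- The per-vertex inequality of the double counting: with Δ = k + e,
-- 2 (Δ t + k (o + t)) + e o = (2k + e)(o + 2t) ≤ (2k + e) 2k = 2k (Δ + k).
vertex-budget : ∀ {k Δ o t} → k ≤ Δ → o + 2 * t ≤ 2 * k → Δ * t + k * (o + t) ≤ k * (Δ + k)
vertex-budget {k} {Δ} {o} {t} k≤Δ weight with m≤n⇒∃[o]m+o≡n k≤Δ
... | e , refl = *-cancelˡ-≤ 2 (begin
    2 * ((k + e) * t + k * (o + t))     ≤⟨ m≤m+n _ (e * o) ⟩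
    2 * ((k + e) * t + k * (o + t)) + e * o ≡⟨ expand k e o t ⟩
    (k + e + k) * (o + 2 * t)           ≤⟨ *-monoʳ-≤ (k + e + k) weight ⟩
    (k + e + k) * (2 * k)               ≡⟨ regroup k e ⟩
    2 * (k * (k + e + k))               ∎)
  where
  open ≤-Reasoning
  expand : ∀ k e o t → 2 * ((k + e) * t + k * (o + t)) + e * o ≡ (k + e + k) * (o + 2 * t)
  expand = solve-∀
  regroup : ∀ k e → (k + e + k) * (2 * k) ≡ 2 * (k * (k + e + k))
  regroup = solve-∀

<double⇒≤ : ∀ {k d} → 1 ≤ k → d < 2 * k → d ≤ (k ∸ 1) + k
<double⇒≤ {suc k} _ (s≤s d≤) = ≤-trans d≤ (≤-reflexive (cong (λ x → k + suc x) (+-identityʳ k)))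

distinct-not-constant : ∀ {d} {A B : Set} (fam : Fin d → A → B) → 2 ≤ d →
  (∀ i j → i ≢ j → ¬ (∀ v → fam i v ≡ fam j v)) → ¬ (∀ i j v → fam i v ≡ fam j v)
distinct-not-constant fam (s≤s (s≤s z≤n)) distinct same =
  distinct zero (suc zero) (λ ()) (same zero (suc zero))

module RomanFamily {n d k : ℕ} {G : Graph n} {fam : Fin d → Fin n → Fin 3}
                   (F : IsRkkFamily k G fam) where
  open IsRkkFamily F

  Δ : ℕ
  Δ = maxDegree G

  adj : Fin n → Fin n → ℕ
  adj v u = ind (Adj G v u)

  zeros ones twos : Fin n → ℕ
  zeros u = ∑[ i < d ] ind (isZero (fam i u))
  ones  u = ∑[ i < d ] ind (isOne (fam i u))
  twos  u = ∑[ i < d ] ind (isTwo (fam i u))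

  family-size : ∀ u → d ≡ zeros u + ones u + twos u
  family-size u = begin
    d                                    ≡⟨ sym (*-identityʳ d) ⟩
    d * 1                                ≡⟨ sym (sum-const d 1) ⟩
    ∑[ i < d ] 1                         ≡⟨ sum-cong-≗ (λ i → sym (value-partition (fam i u))) ⟩
    ∑[ i < d ] (ind (isZero (fam i u)) + ind (isOne (fam i u)) + ind (isTwo (fam i u)))
                                         ≡⟨ ∑-distrib-+ {d} _ _ ⟩
    ∑[ i < d ] (ind (isZero (fam i u)) + ind (isOne (fam i u))) + twos u
                                         ≡⟨ cong (_+ twos u) (∑-distrib-+ {d} _ _) ⟩
    zeros u + ones u + twos u            ∎
    where open ≡-Reasoning

  weight-bound : ∀ u → ones u + 2 * twos u ≤ 2 * k
  weight-bound u = subst (_≤ 2 * k) weight≡ (bounded u)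
    where
    open ≡-Reasoning
    weight≡ : sumFin (λ i → toℕ (fam i u)) ≡ ones u + 2 * twos u
    weight≡ = begin
      sumFin (λ i → toℕ (fam i u))       ≡⟨ sumFin≡sum {d} _ ⟩
      ∑[ i < d ] toℕ (fam i u)           ≡⟨ sum-cong-≗ (λ i → value-weight (fam i u)) ⟩
      ∑[ i < d ] (ind (isOne (fam i u)) + 2 * ind (isTwo (fam i u)))
                                         ≡⟨ ∑-distrib-+ {d} _ _ ⟩
      ones u + ∑[ i < d ] (2 * ind (isTwo (fam i u)))
                                         ≡⟨ cong (ones u +_) (sym (*-distribˡ-sum {d} 2 _)) ⟩
      ones u + 2 * twos u                ∎

  domination : ∀ i v → k * ind (isZero (fam i v)) ≤ ∑[ u < n ] (adj v u * ind (isTwo (fam i u)))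
  domination i v with fam i v in eq
  ... | zero = begin
    k * 1                                ≡⟨ *-identityʳ k ⟩
    k                                    ≤⟨ each i v eq ⟩
    count (λ u → Adj G v u ∧ isTwo (fam i u)) ≡⟨ count-∧ (Adj G v) (λ u → isTwo (fam i u)) ⟩
    ∑[ u < n ] (adj v u * ind (isTwo (fam i u))) ∎
    where open ≤-Reasoning
  ... | suc _ = ≤-trans (≤-reflexive (*-zeroʳ k)) z≤n

  column-degree : ∀ u → ∑[ v < n ] adj v u ≤ Δ
  column-degree u = subst (_≤ Δ) degree≡ (≤maxFin (degree G) u)
    where
    degree≡ : degree G u ≡ ∑[ v < n ] adj v u
    degree≡ = trans (count≡sum (Adj G u)) (sum-cong-≗ (λ v → cong ind (Graph.sym G u v)))

  -- Double counting the pairs (0 of fᵢ at v, 2 of fᵢ at a neighbour u of v).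
  double-count : ∑[ v < n ] (k * zeros v) ≤ ∑[ u < n ] (Δ * twos u)
  double-count = begin
    ∑[ v < n ] (k * zeros v)
      ≡⟨ sum-cong-≗ {n} (λ v → *-distribˡ-sum {d} k _) ⟩
    ∑[ v < n ] ∑[ i < d ] (k * ind (isZero (fam i v)))
      ≤⟨ sum-mono (λ v → sum-mono (λ i → domination i v)) ⟩
    ∑[ v < n ] ∑[ i < d ] ∑[ u < n ] (adj v u * ind (isTwo (fam i u)))
      ≡⟨ sum-cong-≗ {n} (λ v → ∑-comm {d} {n} _) ⟩
    ∑[ v < n ] ∑[ u < n ] ∑[ i < d ] (adj v u * ind (isTwo (fam i u)))
      ≡⟨ ∑-comm {n} {n} _ ⟩
    ∑[ u < n ] ∑[ v < n ] ∑[ i < d ] (adj v u * ind (isTwo (fam i u)))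
      ≡⟨ sum-cong-≗ {n} (λ u → sum-cong-≗ {n} (λ v → sym (*-distribˡ-sum {d} (adj v u) _))) ⟩
    ∑[ u < n ] ∑[ v < n ] (adj v u * twos u)
      ≡⟨ sum-cong-≗ {n} (λ u → sym (*-distribʳ-sum {n} (twos u) _)) ⟩
    ∑[ u < n ] ((∑[ v < n ] adj v u) * twos u)
      ≤⟨ sum-mono (λ u → *-monoˡ-≤ (twos u) (column-degree u)) ⟩
    ∑[ u < n ] (Δ * twos u) ∎
    where open ≤-Reasoning

  -- The bound when k ≤ Δ: sum k d = k z(u) + k (o(u) + t(u)) over all vertices u
  -- and bound the z-part by double counting, the rest by vertex-budget.
  highDegree-bound : 1 ≤ k → k ≤ Δ → d ≤ Δ + k
  highDegree-bound 1≤k k≤Δ =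
    *-cancelˡ-≤ k {{>-nonZero 1≤k}} (*-cancelˡ-≤ n {{nonEmpty G (≤-trans 1≤k k≤Δ)}} total)
    where
    open ≤-Reasoning
    vertex-split : ∀ u → k * d ≡ k * zeros u + k * (ones u + twos u)
    vertex-split u = trans (cong (k *_) (trans (family-size u) (+-assoc (zeros u) (ones u) (twos u))))
                           (*-distribˡ-+ k (zeros u) (ones u + twos u))
    total : n * (k * d) ≤ n * (k * (Δ + k))
    total = begin
      n * (k * d)                        ≡⟨ sym (sum-const n _) ⟩
      ∑[ u < n ] (k * d)                 ≡⟨ sum-cong-≗ vertex-split ⟩
      ∑[ u < n ] (k * zeros u + k * (ones u + twos u))
                                         ≡⟨ ∑-distrib-+ {n} _ _ ⟩
      ∑[ u < n ] (k * zeros u) + ∑[ u < n ] (k * (ones u + twos u))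
                                         ≤⟨ +-monoˡ-≤ _ double-count ⟩
      ∑[ u < n ] (Δ * twos u) + ∑[ u < n ] (k * (ones u + twos u))
                                         ≡⟨ sym (∑-distrib-+ {n} _ _) ⟩
      ∑[ u < n ] (Δ * twos u + k * (ones u + twos u))
                                         ≤⟨ sum-mono (λ u → vertex-budget k≤Δ (weight-bound u)) ⟩
      ∑[ u < n ] (k * (Δ + k))           ≡⟨ sum-const n _ ⟩
      n * (k * (Δ + k))                  ∎

  -- When Δ < k no vertex has k neighbours, so no function takes the value 0.
  positive-values : Δ < k → ∀ i v → 1 ≤ toℕ (fam i v)
  positive-values Δ<k i v with fam i v in eq
  ... | zero  = ⊥-elim (<⇒≱ Δ<k (begin
    k                                    ≤⟨ each i v eq ⟩
    count (λ u → Adj G v u ∧ isTwo (fam i u)) ≤⟨ count-∧-≤ (Adj G v) (λ u → isTwo (fam i u)) ⟩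
    degree G v                           ≤⟨ ≤maxFin (degree G) v ⟩
    Δ                                    ∎))
    where open ≤-Reasoning
  ... | suc _ = s≤s z≤n

  -- The bound when Δ < k: for d ≥ 2k all values would be 1.
  lowDegree-bound : 1 ≤ k → Δ < k → d < 2 * k
  lowDegree-bound 1≤k Δ<k = ≰⇒> λ 2k≤d →
    distinct-not-constant fam (≤-trans (*-monoʳ-≤ 2 1≤k) 2k≤d) distinct (all-equal 2k≤d)
    where
    all-one : 2 * k ≤ d → ∀ i v → toℕ (fam i v) ≡ 1
    all-one 2k≤d i v = sum-tight (λ j → toℕ (fam j v)) (λ j → positive-values Δ<k j v)
      (≤-trans (≤-reflexive (sym (sumFin≡sum {d} _))) (≤-trans (bounded v) 2k≤d)) i
    all-equal : 2 * k ≤ d → ∀ i j v → fam i v ≡ fam j v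
    all-equal 2k≤d i j v = toℕ-injective (trans (all-one 2k≤d i v) (sym (all-one 2k≤d j v)))

corollary2 : (k : ℕ) → 1 ≤ k → (n : ℕ) → (G : Graph n) → (d : ℕ) → (fam : Fin d → Fin n → Fin 3) → IsRkkFamily k G fam → d ≤ (maxDegree G ⊔ (k ∸ 1)) + k
corollary2 k 1≤k n G d fam F with maxDegree G <? k
... | yes Δ<k = ≤-trans (<double⇒≤ 1≤k (RomanFamily.lowDegree-bound F 1≤k Δ<k))
                        (+-monoˡ-≤ k (m≤n⊔m (maxDegree G) (k ∸ 1)))
... | no  Δ≮k = ≤-trans (RomanFamily.highDegree-bound F 1≤k (≮⇒≥ Δ≮k))
                        (+-monoˡ-≤ k (m≤m⊔n (maxDegree G) (k ∸ 1)))
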